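{- Let $(V,\mathcal{B})$ be a $(v,k,1)$-BIBD with well-distributed minimal sub-BIBDs, whose minimal sub-BIBDs are $(v',k,1)$-BIBDs. Suppose that $k\geq 4$. Then one of the following holds: (a) $v<\frac{1}{2}\left(1-\sqrt{1-\frac{4}{k}}\right)v'^{2}+\frac{1}{2}$; (b) $v>\frac{1}{2}\left(1+\sqrt{1-\frac{4}{k}}\right)v'^{2}+\frac{1}{2}$.
   Context: A $(v,k,\lambda)$-BIBD is a pair $(V,\mathcal{B})$ where $V$ is a finite set of $v$ points and $\mathcal{B}$ is a set (no repeated blocks) of $k$-subsets of $V$, $k>1$, such that every pair of distinct points lies in exactly $\lambda$ blocks; trivial cases are excluded. A sub-BIBD of a $(v,k,1)$-BIBD $(V,\mathcal{B})$ is a pair $(V',\mathcal{B}')$ with $V'\subseteq V$, $\mathcal{B}'\subseteq\{B\in\mathcal{B}:B\subseteq V'\}$, which is itself a $(v',k,1)$-BIBD. A sub-BIBD is minimal if $v'$ is minimal among all sub-BIBDs with $v'>k$. $(V,\mathcal{B})$ has well-distributed minimal sub-BIBDs if there are integers $l,m$ such that every point lies in exactly $l$ minimal sub-BIBDs and every block lies in exactly $m$ minimal sub-BIBDs. -}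

module Defs where

open import Data.Nat using (ℕ; _<_; _≤_; _+_; _*_; _∸_; _^_)
open import Data.Bool using (_∧_)
open import Data.Fin using (Fin)
open import Data.Fin.Subset using (Subset; _∈_; _⊆_; _∩_; ∣_∣; ⊤)
open import Data.Fin.Subset.Properties using (_∈?_)
open import Data.Vec using (tabulate)
open import Data.List using (List; length)
open import Data.List.Relation.Unary.All using (All)
open import Data.List.Relation.Unary.Unique.Propositional using (Unique)
import Data.List.Membership.Propositional as Mem
open import Data.Product using (Σ; _×_)
open import Relation.Nullary.Decidable using (⌊_⌋)
open import Relation.Nullary using (¬_)
open import Relation.Binary.PropositionalEquality using (_≡_; _≢_)

-- A block family on points Fin n is an indexed family Bs : Fin b → Subset n.
-- A "design on (P, I)" is the pair (V', B') with V' = P ⊆ Fin n and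
-- B' = { Bs i | i ∈ I }, I ⊆ Fin b.

blocksThrough : ∀ {n b} → (Fin b → Subset n) → Subset b → Fin n → Fin n → Subset b
blocksThrough Bs I x y = I ∩ tabulate (λ i → ⌊ x ∈? Bs i ⌋ ∧ ⌊ y ∈? Bs i ⌋)

record IsBIBD {n b : ℕ} (P : Subset n) (Bs : Fin b → Subset n) (I : Subset b)
              (k λ' : ℕ) : Set where
  field
    k>1        : 1 < k
    nontrivial : k < ∣ P ∣
    noRepeats  : ∀ i j → i ∈ I → j ∈ I → Bs i ≡ Bs j → i ≡ j
    blockSize  : ∀ i → i ∈ I → ∣ Bs i ∣ ≡ k
    blockInP   : ∀ i → i ∈ I → Bs i ⊆ P
    balanced   : ∀ x y → x ∈ P → y ∈ P → x ≢ y → ∣ blocksThrough Bs I x y ∣ ≡ λ'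

IsDesign : ∀ {v b} → (Fin b → Subset v) → ℕ → Set
IsDesign Bs k = IsBIBD ⊤ Bs ⊤ k 1

-- (V', B') is a sub-BIBD of (V, B): V' ⊆ V (automatic), B' ⊆ {B ∈ B : B ⊆ V'}
-- (enforced by blockInP), and (V', B') is a (|V'|, k, 1)-BIBD.
SubBIBD : ∀ {v b} → (Fin b → Subset v) → ℕ → Subset v × Subset b → Set
SubBIBD Bs k (V' Data.Product., I) = IsBIBD V' Bs I k 1

MinimalSubBIBD : ∀ {v b} → (Fin b → Subset v) → ℕ → Subset v × Subset b → Set
MinimalSubBIBD Bs k (V' Data.Product., I) =
  SubBIBD Bs k (V' Data.Product., I) × k < ∣ V' ∣ ×
  (∀ W J → SubBIBD Bs k (W Data.Product., J) → k < ∣ W ∣ → ∣ V' ∣ ≤ ∣ W ∣)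

ExactlyN : {A : Set} → (A → Set) → ℕ → Set
ExactlyN {A} Q l = Σ (List A) λ L →
  Unique L × All Q L × (∀ a → Q a → a Mem.∈ L) × length L ≡ l

WellDistributed : ∀ {v b} → (Fin b → Subset v) → ℕ → Set
WellDistributed {v} {b} Bs k = Σ ℕ λ l → Σ ℕ λ m →
  (∀ (x : Fin v) → ExactlyN (λ (p : Subset v × Subset b) →
       MinimalSubBIBD Bs k p × x ∈ Data.Product.proj₁ p) l) ×
  (∀ (i : Fin b) → ExactlyN (λ (p : Subset v × Subset b) →
       MinimalSubBIBD Bs k p × i ∈ Data.Product.proj₂ p) m)

-- Real-valued conditions, cleared of the square root s = √(1 - 4/k) (k ≥ 4).
-- Put x = (2v - 1)/v'^2.
-- (a)  v < ½(1 - s) v'^2 + ½   ⟺  1 - x > s  ⟺  1 - x > 0 ∧ k (1-x)^2 > k - 4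
--      ⟺  2v < v'^2 + 1 ∧ k (v'^2 + 1 - 2v)^2 > (k - 4) v'^4
CondA : ℕ → ℕ → ℕ → Set
CondA k v v' = 2 * v < v' ^ 2 + 1 ×
               (k ∸ 4) * v' ^ 4 < k * ((v' ^ 2 + 1) ∸ 2 * v) ^ 2
-- (b)  v > ½(1 + s) v'^2 + ½   ⟺  x - 1 > s  ⟺  x - 1 > 0 ∧ k (x-1)^2 > k - 4
--      ⟺  v'^2 + 1 < 2v ∧ k (2v - v'^2 - 1)^2 > (k - 4) v'^4
CondB : ℕ → ℕ → ℕ → Set
CondB k v v' = v' ^ 2 + 1 < 2 * v ×
               (k ∸ 4) * v' ^ 4 < k * (2 * v ∸ (v' ^ 2 + 1)) ^ 2

-- Fix a minimal sub-BIBD S with point set A, |A| = v′ = u.  Two sub-BIBDs of a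
-- (v,k,1)-BIBD with two common points share the block through them, so every
-- minimal sub-BIBD T meets A in c_T ≤ 1 or c_T ≥ k points: (c_T − 1)(c_T − k) ≥ 0.
-- Every point lies in l and every pair of points in m minimal sub-BIBDs, so double
-- counting over the g minimal sub-BIBDs gives g u = v l, (u − 1) l = (v − 1) m,
-- Σ c_T = u l and Σ c_T² = u l + u (u − 1) m.  Summing the inequality and
-- eliminating l and g leaves
--   P(v) = k v² − k (u² + 1) v + k u² + u² (u − 1)² ≥ 0,
-- and 4 P(v) = k (u² + 1 − 2v)² − (k − 4) u⁴ − u² (8u − 4 − 2k) − k, whose last two
-- terms are negative for u > k ≥ 4.  So k (u² + 1 − 2v)² > (k − 4) u⁴, which is the
-- theorem with the square root cleared.  Constructively a minimal sub-BIBD exists only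
-- under double negation, which suffices because the conclusion is decidable.
module Submission where

open import Defs
open import Data.Nat using (ℕ; _≤_)
open import Data.Fin using (Fin)
open import Data.Fin.Subset using (Subset; ∣_∣)
open import Data.Product using (_×_; _,_)
open import Data.Sum using (_⊎_)
open import Relation.Binary.PropositionalEquality using (_≡_)

open import Data.Bool using (Bool; true; false; _∧_)
import Data.Bool as Bool
open import Data.Bool.Properties using (T-∧; T-≡; ∧-conicalˡ; ∧-conicalʳ)
open import Data.Fin using (zero; suc)
open import Data.Fin.Properties using (_≟_; suc-injective)
open import Data.Fin.Subset using (_∈_; _∩_; ⊤; Nonempty)
open import Data.Fin.Subset.Properties
  using (_∈?_; ∈⊤; x∈p∩q⁺; x∈p∩q⁻; p⊆q⇒∣p∣≤∣q∣; ∣⁅x⁆∣≡1; x∈⁅y⁆⇒x≡y; x∈p∧x≢y⇒x∈p-y;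
         x∈p⇒∣p-x∣<∣p∣; ∣p∣≤n; ∣⊤∣≡n; ∩-idem; ∩-identityˡ; ∩-identityʳ)
open import Data.List using (List; []; _∷_; length; filter; deduplicate; concatMap; allFin)
import Data.List as List
open import Data.List.Membership.Propositional using (lose) renaming (_∈_ to _∈ₗ_)
open import Data.List.Membership.Propositional.Properties
  using (∈-filter⁺; ∈-filter⁻; ∈-deduplicate⁺; ∈-deduplicate⁻; ∈-concatMap⁺; ∈-concatMap⁻; ∈-allFin; ∈-lookup)
open import Data.List.Membership.Propositional.Properties.WithK using (unique∧set⇒bag)
open import Data.List.Relation.Binary.BagAndSetEquality using (∼bag⇒↭)
open import Data.List.Relation.Binary.Permutation.Propositional.Properties using (↭-length)
open import Data.List.Relation.Unary.All as All using ()
open import Data.List.Relation.Unary.Any using (here; there; satisfied)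
open import Data.List.Relation.Unary.Unique.Propositional using (Unique)
open import Data.List.Relation.Unary.Unique.Propositional.Properties using (filter⁺)
open import Data.List.Relation.Unary.Unique.DecPropositional.Properties using (deduplicate-!)
open import Data.Nat using (zero; suc; _+_; _*_; _∸_; _^_; _<_; z≤n; s≤s; _≤?_; _<?_; >-nonZero)
open import Data.Nat.Properties
  using (+-*-semiring; *-commutativeSemigroup; +-comm; +-identityʳ; *-identityˡ; *-identityʳ; *-zeroʳ; *-assoc;
         *-distribˡ-+; +-mono-≤; +-monoˡ-≤; +-monoʳ-≤; *-monoʳ-≤; +-cancelˡ-≡; +-cancelʳ-≡;
         +-cancelˡ-≤; +-cancelʳ-≤; *-cancelˡ-≡; *-cancelˡ-≤; ≤-refl; ≤-reflexive; ≤-trans; <-≤-trans;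
         ≤-pred; <-irrefl; ≮⇒≥; ≰⇒>; n≮0; <⇒≤; <-cmp; m<m+n; m≤m+n; m∸n+n≡m; m+[n∸m]≡n;
         m≤n⇒∃[o]m+o≡n; module ≤-Reasoning)
open import Data.Nat.Solver using (module +-*-Solver)
open +-*-Solver using (_:+_; _:*_; _:^_; _:=_; con)
open import Data.Nat.Tactic.RingSolver using (solve-∀; solve)
open import Data.Product using (∃; ∃₂; proj₁; proj₂)
open import Data.Product.Function.NonDependent.Propositional using (_×-⇔_)
open import Data.Product.Properties using (≡-dec)
open import Data.Sum using (inj₁; inj₂)
open import Data.Vec as Vec using (here; there; lookup)
open import Data.Vec.Properties using (lookup-zipWith; lookup∘tabulate; []=⇒lookup; lookup⇒[]=)
import Data.Vec.Properties as Vecₚ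
open import Function using (_∘_; _⇔_; Equivalence; mk⇔)
open import Relation.Binary.Definitions using (tri<; tri≈; tri>)
open import Relation.Binary.PropositionalEquality
  using (_≢_; refl; sym; trans; cong; cong₂; subst; module ≡-Reasoning)
open import Relation.Nullary using (¬_; Dec; yes; no; does; contradiction)
open import Relation.Nullary.Decidable using (⌊_⌋; toWitness; fromWitness; decidable-stable; _×-dec_; _⊎-dec_)
open import Algebra.Properties.CommutativeSemigroup *-commutativeSemigroup using (x∙yz≈y∙xz)
open import Algebra.Properties.Semiring.Sum +-*-semiring
  using (sum-syntax; sum-cong-≗; ∑-comm; ∑-distrib-+; *-distribˡ-sum; *-distribʳ-sum)

open Equivalence using (to; from)

private variable
  n : ℕ
  p : Subset n
  x y : Fin n

-- Indicator functions and finite sums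

𝟙 : Bool → ℕ
𝟙 true  = 1
𝟙 false = 0

𝟙-∧ : ∀ a b → 𝟙 (a ∧ b) ≡ 𝟙 a * 𝟙 b
𝟙-∧ true  b = sym (+-identityʳ (𝟙 b))
𝟙-∧ false b = refl

𝟙-idem : ∀ a → 𝟙 a * 𝟙 a ≡ 𝟙 a
𝟙-idem true  = refl
𝟙-idem false = refl

∑-mono-≤ : ∀ {f g : Fin n → ℕ} → (∀ i → f i ≤ g i) → ∑[ i < n ] f i ≤ ∑[ i < n ] g i
∑-mono-≤ {zero}  f≤g = z≤n
∑-mono-≤ {suc n} f≤g = +-mono-≤ (f≤g zero) (∑-mono-≤ (f≤g ∘ suc))

∑-const : ∀ n c → ∑[ i < n ] c ≡ n * c
∑-const zero    c = refl
∑-const (suc n) c = cong (c +_) (∑-const n c)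

∑-+-≡ : ∀ {f g h k : Fin n → ℕ} → (∀ i → f i + g i ≡ h i + k i) →
  ∑[ i < n ] f i + ∑[ i < n ] g i ≡ ∑[ i < n ] h i + ∑[ i < n ] k i
∑-+-≡ {f = f} {g} {h} {k} e = begin
  ∑[ i < _ ] f i + ∑[ i < _ ] g i  ≡⟨ ∑-distrib-+ f g ⟨
  ∑[ i < _ ] (f i + g i)          ≡⟨ sum-cong-≗ e ⟩
  ∑[ i < _ ] (h i + k i)          ≡⟨ ∑-distrib-+ h k ⟩
  ∑[ i < _ ] h i + ∑[ i < _ ] k i  ∎
  where open ≡-Reasoning

δ : Fin n → Fin n → ℕ
δ x y = 𝟙 (does (x ≟ y))

∑-δ : ∀ (f : Fin n → ℕ) x → ∑[ y < n ] (f y * δ x y) ≡ f x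
∑-δ {suc n} f zero = begin
  f zero * 1 + ∑[ y < n ] (f (suc y) * 0) ≡⟨ cong₂ _+_ (*-identityʳ (f zero)) (sum-cong-≗ (*-zeroʳ ∘ f ∘ suc)) ⟩
  f zero + ∑[ y < n ] 0                   ≡⟨ cong (f zero +_) (trans (∑-const n 0) (*-zeroʳ n)) ⟩
  f zero + 0                              ≡⟨ +-identityʳ (f zero) ⟩
  f zero                                  ∎
  where open ≡-Reasoning
∑-δ {suc n} f (suc x) = cong₂ _+_ (*-zeroʳ (f zero)) (∑-δ (f ∘ suc) x)

χ : Subset n → Fin n → ℕ
χ p x = 𝟙 (lookup p x)

∣p∣≡∑χ : ∀ (p : Subset n) → ∣ p ∣ ≡ ∑[ x < n ] χ p x
∣p∣≡∑χ Vec.[]          = refl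
∣p∣≡∑χ (true Vec.∷ p)  = cong suc (∣p∣≡∑χ p)
∣p∣≡∑χ (false Vec.∷ p) = ∣p∣≡∑χ p

∣p∩q∣≡∑χχ : ∀ (p q : Subset n) → ∣ p ∩ q ∣ ≡ ∑[ x < n ] (χ p x * χ q x)
∣p∩q∣≡∑χχ p q = trans (∣p∣≡∑χ (p ∩ q))
  (sum-cong-≗ λ x → trans (cong 𝟙 (lookup-zipWith _∧_ x p q)) (𝟙-∧ (lookup p x) (lookup q x)))

-- Counting along duplicate-free lists

module _ {A : Set} where

  ∑𝟙≡∣filter∣ : ∀ (f : A → Bool) xs →
    ∑[ i < length xs ] 𝟙 (f (List.lookup xs i)) ≡ length (filter (λ a → f a Bool.≟ true) xs)
  ∑𝟙≡∣filter∣ f []       = refl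
  ∑𝟙≡∣filter∣ f (a ∷ xs) with f a
  ... | true  = cong suc (∑𝟙≡∣filter∣ f xs)
  ... | false = ∑𝟙≡∣filter∣ f xs

  ∑𝟙≡ExactlyN : ∀ (f : A → Bool) {xs Q l} → Unique xs → ExactlyN Q l →
    (∀ {a} → (a ∈ₗ xs × f a ≡ true) ⇔ Q a) →
    ∑[ i < length xs ] 𝟙 (f (List.lookup xs i)) ≡ l
  ∑𝟙≡ExactlyN f {xs} !xs (ys , !ys , all-Q , complete , refl) xs∩f⇔Q = trans (∑𝟙≡∣filter∣ f xs)
    (↭-length (∼bag⇒↭ (unique∧set⇒bag (filter⁺ f? !xs) !ys (mk⇔
      (λ a∈ → complete _ (to xs∩f⇔Q (∈-filter⁻ f? a∈)))
      (λ a∈ → let a∈xs , fa = from xs∩f⇔Q (All.lookup all-Q a∈) in ∈-filter⁺ f? a∈xs fa)))))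
    where f? = λ a → f a Bool.≟ true

  ExactlyN⇔ : ∀ {Q : A → Set} {l} (e : ExactlyN Q l) {a} → a ∈ₗ proj₁ e ⇔ Q a
  ExactlyN⇔ (_ , _ , all-Q , complete , _) = mk⇔ (All.lookup all-Q) (complete _)

  ExactlyN-0< : ∀ {Q : A → Set} {l a} → ExactlyN Q l → Q a → 0 < l
  ExactlyN-0< (_ , _ , _ , complete , refl) Qa with complete _ Qa
  ... | here  _ = s≤s z≤n
  ... | there _ = s≤s z≤n

module PairwiseBalanced {g n l m : ℕ} (B : Fin g → Subset n)
  (replication : ∀ x → ∑[ t < g ] χ (B t) x ≡ l)
  (index : ∀ {x y} → x ≢ y → ∑[ t < g ] (χ (B t) x * χ (B t) y) ≡ m) where

  private
    factor : ∀ a b c d → a * b + a * c * d ≡ a * (b + c * d)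
    factor = solve-∀
    expand : ∀ a c d e → a * (c * d + e) ≡ a * c * d + a * e
    expand = solve-∀

  pairs : Fin n → Fin n → ℕ
  pairs x y = ∑[ t < g ] (χ (B t) x * χ (B t) y)

  pairs+δ : ∀ x y → pairs x y + δ x y * m ≡ δ x y * l + m
  pairs+δ x y with x ≟ y
  ... | yes refl = trans (cong₂ _+_ (trans (sum-cong-≗ λ t → 𝟙-idem (lookup (B t) x)) (replication x)) (*-identityˡ m))
                         (cong (_+ m) (sym (*-identityˡ l)))
  ... | no x≢y   = trans (+-identityʳ _) (index x≢y)

  ∑∣∩∣ : ∀ X → ∑[ t < g ] ∣ X ∩ B t ∣ ≡ ∣ X ∣ * l
  ∑∣∩∣ X = begin
    ∑[ t < g ] ∣ X ∩ B t ∣                    ≡⟨ sum-cong-≗ (∣p∩q∣≡∑χχ X ∘ B) ⟩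
    ∑[ t < g ] ∑[ x < n ] (χ X x * χ (B t) x) ≡⟨ ∑-comm (λ t x → χ X x * χ (B t) x) ⟩
    ∑[ x < n ] ∑[ t < g ] (χ X x * χ (B t) x) ≡⟨ sum-cong-≗ (λ x → *-distribˡ-sum (χ X x) (λ t → χ (B t) x)) ⟨
    ∑[ x < n ] (χ X x * ∑[ t < g ] χ (B t) x) ≡⟨ sum-cong-≗ (λ x → cong (χ X x *_) (replication x)) ⟩
    ∑[ x < n ] (χ X x * l)                    ≡⟨ *-distribʳ-sum l (χ X) ⟨
    ∑[ x < n ] χ X x * l                      ≡⟨ cong (_* l) (∣p∣≡∑χ X) ⟨
    ∣ X ∣ * l                                 ∎
    where open ≡-Reasoning

  ∑χ*∣∩∣ : ∀ x Y → ∑[ t < g ] (χ (B t) x * ∣ Y ∩ B t ∣) + χ Y x * m ≡ χ Y x * l + ∣ Y ∣ * m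
  ∑χ*∣∩∣ x Y = begin
    ∑[ t < g ] (χ (B t) x * ∣ Y ∩ B t ∣) + χ Y x * m
      ≡⟨ cong₂ _+_ swap (cong (_* m) (∑-δ (χ Y) x)) ⟨
    ∑[ y < n ] (χ Y y * pairs x y) + ∑[ y < n ] (χ Y y * δ x y) * m
      ≡⟨ cong (∑[ y < n ] (χ Y y * pairs x y) +_) (*-distribʳ-sum m (λ y → χ Y y * δ x y)) ⟩
    ∑[ y < n ] (χ Y y * pairs x y) + ∑[ y < n ] (χ Y y * δ x y * m)
      ≡⟨ ∑-+-≡ row ⟩
    ∑[ y < n ] (χ Y y * δ x y * l) + ∑[ y < n ] (χ Y y * m)
      ≡⟨ cong₂ _+_ (*-distribʳ-sum l (λ y → χ Y y * δ x y)) (*-distribʳ-sum m (χ Y)) ⟨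
    ∑[ y < n ] (χ Y y * δ x y) * l + ∑[ y < n ] χ Y y * m
      ≡⟨ cong₂ (λ a b → a * l + b * m) (∑-δ (χ Y) x) (sym (∣p∣≡∑χ Y)) ⟩
    χ Y x * l + ∣ Y ∣ * m ∎
    where
    open ≡-Reasoning
    swap : ∑[ y < n ] (χ Y y * pairs x y) ≡ ∑[ t < g ] (χ (B t) x * ∣ Y ∩ B t ∣)
    swap = begin
      ∑[ y < n ] (χ Y y * pairs x y)
        ≡⟨ sum-cong-≗ (λ y → *-distribˡ-sum (χ Y y) (λ t → χ (B t) x * χ (B t) y)) ⟩
      ∑[ y < n ] ∑[ t < g ] (χ Y y * (χ (B t) x * χ (B t) y))
        ≡⟨ ∑-comm (λ y t → χ Y y * (χ (B t) x * χ (B t) y)) ⟩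
      ∑[ t < g ] ∑[ y < n ] (χ Y y * (χ (B t) x * χ (B t) y))
        ≡⟨ sum-cong-≗ (λ t → sum-cong-≗ λ y → x∙yz≈y∙xz (χ Y y) (χ (B t) x) (χ (B t) y)) ⟩
      ∑[ t < g ] ∑[ y < n ] (χ (B t) x * (χ Y y * χ (B t) y))
        ≡⟨ sum-cong-≗ (λ t → *-distribˡ-sum (χ (B t) x) (λ y → χ Y y * χ (B t) y)) ⟨
      ∑[ t < g ] (χ (B t) x * ∑[ y < n ] (χ Y y * χ (B t) y))
        ≡⟨ sum-cong-≗ (λ t → cong (χ (B t) x *_) (∣p∩q∣≡∑χχ Y (B t))) ⟨
      ∑[ t < g ] (χ (B t) x * ∣ Y ∩ B t ∣) ∎
    row : ∀ y → χ Y y * pairs x y + χ Y y * δ x y * m ≡ χ Y y * δ x y * l + χ Y y * m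
    row y = trans (factor (χ Y y) (pairs x y) (δ x y) m)
                  (trans (cong (χ Y y *_) (pairs+δ x y)) (expand (χ Y y) (δ x y) l m))

  ∑∣∩∣*∣∩∣ : ∀ X Y → ∑[ t < g ] (∣ X ∩ B t ∣ * ∣ Y ∩ B t ∣) + ∣ X ∩ Y ∣ * m ≡ ∣ X ∩ Y ∣ * l + ∣ X ∣ * ∣ Y ∣ * m
  ∑∣∩∣*∣∩∣ X Y = begin
    ∑[ t < g ] (∣ X ∩ B t ∣ * ∣ Y ∩ B t ∣) + ∣ X ∩ Y ∣ * m
      ≡⟨ cong₂ _+_ swap (cong (_* m) (∣p∩q∣≡∑χχ X Y)) ⟩
    ∑[ x < n ] (χ X x * S x) + ∑[ x < n ] (χ X x * χ Y x) * m
      ≡⟨ cong (∑[ x < n ] (χ X x * S x) +_) (*-distribʳ-sum m (λ x → χ X x * χ Y x)) ⟩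
    ∑[ x < n ] (χ X x * S x) + ∑[ x < n ] (χ X x * χ Y x * m)
      ≡⟨ ∑-+-≡ row ⟩
    ∑[ x < n ] (χ X x * χ Y x * l) + ∑[ x < n ] (χ X x * (∣ Y ∣ * m))
      ≡⟨ cong₂ _+_ (*-distribʳ-sum l (λ x → χ X x * χ Y x)) (*-distribʳ-sum (∣ Y ∣ * m) (χ X)) ⟨
    ∑[ x < n ] (χ X x * χ Y x) * l + ∑[ x < n ] χ X x * (∣ Y ∣ * m)
      ≡⟨ cong₂ (λ a b → a * l + b * (∣ Y ∣ * m)) (∣p∩q∣≡∑χχ X Y) (∣p∣≡∑χ X) ⟨
    ∣ X ∩ Y ∣ * l + ∣ X ∣ * (∣ Y ∣ * m)
      ≡⟨ cong (∣ X ∩ Y ∣ * l +_) (*-assoc ∣ X ∣ ∣ Y ∣ m) ⟨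
    ∣ X ∩ Y ∣ * l + ∣ X ∣ * ∣ Y ∣ * m ∎
    where
    open ≡-Reasoning
    S : Fin n → ℕ
    S x = ∑[ t < g ] (χ (B t) x * ∣ Y ∩ B t ∣)
    swap : ∑[ t < g ] (∣ X ∩ B t ∣ * ∣ Y ∩ B t ∣) ≡ ∑[ x < n ] (χ X x * S x)
    swap = begin
      ∑[ t < g ] (∣ X ∩ B t ∣ * ∣ Y ∩ B t ∣)
        ≡⟨ sum-cong-≗ (λ t → cong (_* ∣ Y ∩ B t ∣) (∣p∩q∣≡∑χχ X (B t))) ⟩
      ∑[ t < g ] (∑[ x < n ] (χ X x * χ (B t) x) * ∣ Y ∩ B t ∣)
        ≡⟨ sum-cong-≗ (λ t → *-distribʳ-sum ∣ Y ∩ B t ∣ (λ x → χ X x * χ (B t) x)) ⟩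
      ∑[ t < g ] ∑[ x < n ] (χ X x * χ (B t) x * ∣ Y ∩ B t ∣)
        ≡⟨ ∑-comm (λ t x → χ X x * χ (B t) x * ∣ Y ∩ B t ∣) ⟩
      ∑[ x < n ] ∑[ t < g ] (χ X x * χ (B t) x * ∣ Y ∩ B t ∣)
        ≡⟨ sum-cong-≗ (λ x → sum-cong-≗ λ t → *-assoc (χ X x) (χ (B t) x) ∣ Y ∩ B t ∣) ⟩
      ∑[ x < n ] ∑[ t < g ] (χ X x * (χ (B t) x * ∣ Y ∩ B t ∣))
        ≡⟨ sum-cong-≗ (λ x → *-distribˡ-sum (χ X x) (λ t → χ (B t) x * ∣ Y ∩ B t ∣)) ⟨
      ∑[ x < n ] (χ X x * S x) ∎
    row : ∀ x → χ X x * S x + χ X x * χ Y x * m ≡ χ X x * χ Y x * l + χ X x * (∣ Y ∣ * m)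
    row x = trans (factor (χ X x) (S x) (χ Y x) m)
                  (trans (cong (χ X x *_) (∑χ*∣∩∣ x Y)) (expand (χ X x) (χ Y x) l (∣ Y ∣ * m)))

-- Sub-BIBDs of a (v,k,1)-BIBD

0<∣p∣⇒Nonempty : 0 < ∣ p ∣ → Nonempty p
0<∣p∣⇒Nonempty {p = true Vec.∷ p}  _     = zero , here
0<∣p∣⇒Nonempty {p = false Vec.∷ p} 0<∣p∣ with 0<∣p∣⇒Nonempty 0<∣p∣
... | x , x∈p = suc x , there x∈p

x∈p⇒0<∣p∣ : x ∈ p → 0 < ∣ p ∣
x∈p⇒0<∣p∣ {x = x} x∈p =
  subst (_≤ _) (∣⁅x⁆∣≡1 x) (p⊆q⇒∣p∣≤∣q∣ λ y∈⁅x⁆ → subst (_∈ _) (sym (x∈⁅y⁆⇒x≡y x y∈⁅x⁆)) x∈p)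

1<∣p∣⇒∃≢ : 1 < ∣ p ∣ → ∃₂ λ x y → x ∈ p × y ∈ p × x ≢ y
1<∣p∣⇒∃≢ {p = true Vec.∷ p}  (s≤s 0<∣p∣) with 0<∣p∣⇒Nonempty 0<∣p∣
... | y , y∈p = zero , suc y , here , there y∈p , λ ()
1<∣p∣⇒∃≢ {p = false Vec.∷ p} 1<∣p∣ with 1<∣p∣⇒∃≢ 1<∣p∣
... | x , y , x∈p , y∈p , x≢y = suc x , suc y , there x∈p , there y∈p , x≢y ∘ suc-injective

∈∧∈∧≢⇒1<∣p∣ : x ∈ p → y ∈ p → x ≢ y → 1 < ∣ p ∣
∈∧∈∧≢⇒1<∣p∣ x∈p y∈p x≢y =
  ≤-trans (s≤s (x∈p⇒0<∣p∣ (x∈p∧x≢y⇒x∈p-y y∈p (x≢y ∘ sym)))) (x∈p⇒∣p-x∣<∣p∣ x∈p)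

lookup≡true⇔∈ : lookup p x ≡ true ⇔ x ∈ p
lookup≡true⇔∈ {p = p} {x = x} = mk⇔ (lookup⇒[]= x p) []=⇒lookup

module _ {v b k : ℕ} {Bs : Fin b → Subset v} where

  private variable
    P Q : Subset v
    I J : Subset b
    i j : Fin b

  ∈-blocksThrough⁻ : i ∈ blocksThrough Bs I x y → i ∈ I × x ∈ Bs i × y ∈ Bs i
  ∈-blocksThrough⁻ {i = i} {I} {x} {y} i∈ with x∈p∩q⁻ I _ i∈
  ... | i∈I , i∈t with to (T-∧ {⌊ x ∈? Bs i ⌋}) (from T-≡ (trans (sym (lookup∘tabulate _ i)) ([]=⇒lookup i∈t)))
  ... | x∈i , y∈i = i∈I , toWitness {a? = x ∈? Bs i} x∈i , toWitness {a? = y ∈? Bs i} y∈i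

  ∈-blocksThrough⁺ : i ∈ I → x ∈ Bs i → y ∈ Bs i → i ∈ blocksThrough Bs I x y
  ∈-blocksThrough⁺ {i = i} {x = x} {y = y} i∈I x∈i y∈i = x∈p∩q⁺ (i∈I , lookup⇒[]= i _ (trans (lookup∘tabulate _ i)
    (to T-≡ (from T-∧ (fromWitness {a? = x ∈? Bs i} x∈i , fromWitness {a? = y ∈? Bs i} y∈i)))))

  block-through : IsBIBD P Bs I k 1 → x ∈ P → y ∈ P → x ≢ y → ∃ λ i → i ∈ I × x ∈ Bs i × y ∈ Bs i
  block-through S x∈P y∈P x≢y with 0<∣p∣⇒Nonempty (≤-reflexive (sym (IsBIBD.balanced S _ _ x∈P y∈P x≢y)))
  ... | i , i∈ = i , ∈-blocksThrough⁻ i∈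

  module _ (D : IsDesign Bs k) where

    block-through-unique : x ≢ y → x ∈ Bs i → y ∈ Bs i → x ∈ Bs j → y ∈ Bs j → i ≡ j
    block-through-unique {i = i} {j = j} x≢y x∈i y∈i x∈j y∈j with i ≟ j
    ... | yes i≡j = i≡j
    ... | no  i≢j = contradiction
      (∈∧∈∧≢⇒1<∣p∣ (∈-blocksThrough⁺ ∈⊤ x∈i y∈i) (∈-blocksThrough⁺ ∈⊤ x∈j y∈j) i≢j)
      (<-irrefl (sym (IsBIBD.balanced D _ _ ∈⊤ ∈⊤ x≢y)))

    k≤∣∩∣ : IsBIBD P Bs I k 1 → IsBIBD Q Bs J k 1 → x ∈ P ∩ Q → y ∈ P ∩ Q → x ≢ y → k ≤ ∣ P ∩ Q ∣
    k≤∣∩∣ {P} {Q = Q} S T x∈ y∈ x≢y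
      with x∈p∩q⁻ P Q x∈ | x∈p∩q⁻ P Q y∈
    ... | x∈P , x∈Q | y∈P , y∈Q
      with block-through S x∈P y∈P x≢y | block-through T x∈Q y∈Q x≢y
    ... | i , i∈I , x∈i , y∈i | j , j∈J , x∈j , y∈j
      rewrite block-through-unique x≢y x∈i y∈i x∈j y∈j
      = subst (_≤ ∣ P ∩ Q ∣) (IsBIBD.blockSize T j j∈J)
          (p⊆q⇒∣p∣≤∣q∣ λ z∈j → x∈p∩q⁺ (IsBIBD.blockInP S j i∈I z∈j , IsBIBD.blockInP T j j∈J z∈j))

    ∣∩∣≤1⊎k≤∣∩∣ : IsBIBD P Bs I k 1 → IsBIBD Q Bs J k 1 → ∣ P ∩ Q ∣ ≤ 1 ⊎ k ≤ ∣ P ∩ Q ∣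
    ∣∩∣≤1⊎k≤∣∩∣ {P} {Q = Q} S T with 1 <? ∣ P ∩ Q ∣
    ... | no  1≮ = inj₁ (≮⇒≥ 1≮)
    ... | yes 1< with 1<∣p∣⇒∃≢ 1<
    ...   | x , y , x∈ , y∈ , x≢y = inj₂ (k≤∣∩∣ S T x∈ y∈ x≢y)

    block∈⇔∈∧∈ : IsBIBD Q Bs J k 1 → x ≢ y → x ∈ Bs j → y ∈ Bs j → j ∈ J ⇔ (x ∈ Q × y ∈ Q)
    block∈⇔∈∧∈ T x≢y x∈j y∈j = mk⇔
      (λ j∈J → IsBIBD.blockInP T _ j∈J x∈j , IsBIBD.blockInP T _ j∈J y∈j)
      (λ (x∈Q , y∈Q) → let i , i∈J , x∈i , y∈i = block-through T x∈Q y∈Q x≢y in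
                        subst (_∈ _) (block-through-unique x≢y x∈i y∈i x∈j y∈j) i∈J)

¬¬-minimum : ∀ {A : Set} (P : A → Set) (size : A → ℕ) {a} → P a →
  ¬ ¬ ∃ λ a → P a × ∀ b → P b → size a ≤ size b
¬¬-minimum {A} P size {a} Pa = below (suc (size a)) Pa ≤-refl
  where
  below : ∀ n {a} → P a → size a < n → ¬ ¬ ∃ λ a → P a × ∀ b → P b → size a ≤ size b
  below (suc n) {a} Pa sa<1+n no-minimum = no-minimum (a , Pa , λ b Pb →
    decidable-stable (size a ≤? size b) λ sa≰sb →
      below n Pb (<-≤-trans (≰⇒> sa≰sb) (≤-pred sa<1+n)) no-minimum)

¬¬-minimal-sub-BIBD : ∀ {v b k} {Bs : Fin b → Subset v} → IsDesign Bs k →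
  ¬ ¬ ∃ (MinimalSubBIBD Bs k)
¬¬-minimal-sub-BIBD {k = k} {Bs} D no-minimal =
  ¬¬-minimum (λ (W , J) → SubBIBD Bs k (W , J) × k < ∣ W ∣) (∣_∣ ∘ proj₁) (D , IsBIBD.nontrivial D)
    λ ((V , I) , (S , k<∣V∣) , minimum) →
      no-minimal ((V , I) , S , k<∣V∣ , λ W J S′ k<∣W∣ → minimum (W , J) (S′ , k<∣W∣))

module MinimalSubBIBDs {v b k l m : ℕ} {Bs : Fin b → Subset v} (D : IsDesign Bs k)
  (LF : ∀ x → ExactlyN (λ T → MinimalSubBIBD Bs k T × x ∈ proj₁ T) l)
  (MF : ∀ i → ExactlyN (λ T → MinimalSubBIBD Bs k T × i ∈ proj₂ T) m) where

  minimals : List (Subset v × Subset b)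
  minimals = deduplicate (≡-dec (Vecₚ.≡-dec Bool._≟_) (Vecₚ.≡-dec Bool._≟_)) (concatMap (proj₁ ∘ LF) (allFin v))

  ∈-minimals⇔ : ∀ {T} → T ∈ₗ minimals ⇔ MinimalSubBIBD Bs k T
  ∈-minimals⇔ = mk⇔
    (λ T∈ → let x , T∈Lx = satisfied (∈-concatMap⁻ (proj₁ ∘ LF) {xs = allFin v} (∈-deduplicate⁻ _ _ T∈)) in
            proj₁ (to (ExactlyN⇔ (LF x)) T∈Lx))
    (λ T-min → let x , x∈T = 0<∣p∣⇒Nonempty (≤-trans (s≤s z≤n) (proj₁ (proj₂ T-min))) in
               ∈-deduplicate⁺ _ (∈-concatMap⁺ (proj₁ ∘ LF) (lose (∈-allFin x) (from (ExactlyN⇔ (LF x)) (T-min , x∈T)))))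

  g : ℕ
  g = length minimals

  B : Fin g → Subset v
  B t = proj₁ (List.lookup minimals t)

  B-minimal : ∀ t → MinimalSubBIBD Bs k (List.lookup minimals t)
  B-minimal t = to ∈-minimals⇔ (∈-lookup t)

  replication : ∀ x → ∑[ t < g ] χ (B t) x ≡ l
  replication x = ∑𝟙≡ExactlyN _ (deduplicate-! _ _) (LF x) (∈-minimals⇔ ×-⇔ lookup≡true⇔∈)

  index : ∀ {x y} → x ≢ y → ∑[ t < g ] (χ (B t) x * χ (B t) y) ≡ m
  index {x} {y} x≢y with block-through D ∈⊤ ∈⊤ x≢y
  ... | j , _ , x∈j , y∈j = trans (sum-cong-≗ λ t → sym (𝟙-∧ (lookup (B t) x) (lookup (B t) y)))
    (∑𝟙≡ExactlyN _ (deduplicate-! _ _) (MF j) (mk⇔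
      (λ (T∈ , x∈T∧y∈T) → let T-min = to ∈-minimals⇔ T∈ in
        T-min , from (block∈⇔∈∧∈ D (proj₁ T-min) x≢y x∈j y∈j)
                  (to lookup≡true⇔∈ (∧-conicalˡ _ _ x∈T∧y∈T) , to lookup≡true⇔∈ (∧-conicalʳ _ _ x∈T∧y∈T)))
      (λ (T-min , j∈T) → let x∈T , y∈T = to (block∈⇔∈∧∈ D (proj₁ T-min) x≢y x∈j y∈j) j∈T in
        from ∈-minimals⇔ T-min , cong₂ _∧_ (from lookup≡true⇔∈ x∈T) (from lookup≡true⇔∈ y∈T))))

  0<m : ∀ {S} → MinimalSubBIBD Bs k S → 0 < m
  0<m S-min@(S , k<∣A∣ , _) with 1<∣p∣⇒∃≢ (≤-trans (IsBIBD.k>1 S) (<⇒≤ k<∣A∣))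
  ... | x , y , x∈A , y∈A , x≢y with block-through S x∈A y∈A x≢y
  ...   | j , j∈I , _ = ExactlyN-0< (MF j) (S-min , j∈I)

-- The quadratic inequality

[k+1]*c≤c*c+k : ∀ {k c} → c ≤ 1 ⊎ k ≤ c → (k + 1) * c ≤ c * c + k
[k+1]*c≤c*c+k {k} (inj₁ z≤n)       = ≤-trans (≤-reflexive (*-zeroʳ (k + 1))) z≤n
[k+1]*c≤c*c+k {k} (inj₁ (s≤s z≤n)) = ≤-reflexive (trans (*-identityʳ (k + 1)) (+-comm k 1))
[k+1]*c≤c*c+k {k} (inj₂ k≤c) with m≤n⇒∃[o]m+o≡n k≤c
... | zero  , refl = ≤-reflexive (square k)
  where
  square : ∀ k → (k + 1) * (k + 0) ≡ (k + 0) * (k + 0) + k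
  square = solve-∀
... | suc e , refl = subst ((k + 1) * (k + suc e) ≤_) (split k e) (m≤m+n _ _)
  where
  split : ∀ k e → (k + 1) * (k + suc e) + suc e * (k + e) ≡ (k + suc e) * (k + suc e) + k
  split = solve-∀

-- P(v) ≥ 0 for the quadratic P of the header, with its negative term moved to the left.
Quadratic≥0 : ℕ → ℕ → ℕ → Set
Quadratic≥0 k u v = k * (u * u + 1) * v ≤ (u * (u ∸ 1)) * (u * (u ∸ 1)) + k * (v * v + u * u)

-- Multiplying by u (u − 1) turns g and l into multiples of m: u g = v l, (u − 1) l = (v − 1) m.
quadratic≥0 : ∀ {k u v l m g s} → 0 < u → 0 < v → 0 < m →
  s + u * m ≡ u * l + u * u * m → g * u ≡ v * l → u * l + m ≡ l + v * m →
  (k + 1) * (u * l) ≤ s + g * k → Quadratic≥0 k u v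
quadratic≥0 {k} {u@(suc u₁)} {v@(suc v₁)} {l} {m@(suc m₁)} {g} {s} _ _ _ s+um≡ul+uum gu≡vl ul+m≡l+vm [k+1]ul≤s+gk =
  +-cancelʳ-≤ (u * u * u * u₁ + k * v * v₁) _ _ (begin
    k * (u * u + 1) * v + (u * u * u * u₁ + k * v * v₁)
      ≡⟨ solve (k ∷ u₁ ∷ v₁ ∷ []) ⟩
    (u * u₁) * (u * u₁) + k * (v * v + u * u) + (k * u * u * v₁ + u * u * u₁)
      ≤⟨ +-monoʳ-≤ ((u * u₁) * (u * u₁) + k * (v * v + u * u)) X≤Y ⟩
    (u * u₁) * (u * u₁) + k * (v * v + u * u) + (u * u * u * u₁ + k * v * v₁) ∎)
  where
  open ≤-Reasoning
  u₁l≡v₁m : u₁ * l ≡ v₁ * m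
  u₁l≡v₁m = +-cancelʳ-≡ m _ _ (+-cancelˡ-≡ l _ _ (begin-equality
    l + (u₁ * l + m)  ≡⟨ solve (l ∷ u₁ ∷ m₁ ∷ []) ⟩
    u * l + m         ≡⟨ ul+m≡l+vm ⟩
    l + v * m         ≡⟨ solve (l ∷ v₁ ∷ m₁ ∷ []) ⟩
    l + (v₁ * m + m)  ∎))
  kul+um≤uum+kg : k * u * l + u * m ≤ u * u * m + k * g
  kul+um≤uum+kg = +-cancelˡ-≤ (u * l) _ _ (begin
    u * l + (k * u * l + u * m)  ≡⟨ solve (k ∷ u₁ ∷ l ∷ m₁ ∷ []) ⟩
    (k + 1) * (u * l) + u * m    ≤⟨ +-monoˡ-≤ (u * m) [k+1]ul≤s+gk ⟩
    s + g * k + u * m            ≡⟨ solve (s ∷ g ∷ k ∷ u₁ ∷ m₁ ∷ []) ⟩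
    s + u * m + g * k            ≡⟨ cong (_+ g * k) s+um≡ul+uum ⟩
    u * l + u * u * m + g * k    ≡⟨ solve (u₁ ∷ l ∷ m₁ ∷ g ∷ k ∷ []) ⟩
    u * l + (u * u * m + k * g)  ∎)
  X≤Y : k * u * u * v₁ + u * u * u₁ ≤ u * u * u * u₁ + k * v * v₁
  X≤Y = *-cancelˡ-≤ m (begin
    m * (k * u * u * v₁ + u * u * u₁)      ≡⟨ solve (m₁ ∷ k ∷ u₁ ∷ v₁ ∷ []) ⟩
    k * u * u * (v₁ * m) + u * u * u₁ * m  ≡⟨ cong (λ t → k * u * u * t + u * u * u₁ * m) u₁l≡v₁m ⟨
    k * u * u * (u₁ * l) + u * u * u₁ * m  ≡⟨ solve (k ∷ u₁ ∷ l ∷ m₁ ∷ []) ⟩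
    u * u₁ * (k * u * l + u * m)           ≤⟨ *-monoʳ-≤ (u * u₁) kul+um≤uum+kg ⟩
    u * u₁ * (u * u * m + k * g)           ≡⟨ solve (u₁ ∷ m₁ ∷ k ∷ g ∷ []) ⟩
    u * u * u * u₁ * m + k * u₁ * (g * u)  ≡⟨ cong (λ t → u * u * u * u₁ * m + k * u₁ * t) gu≡vl ⟩
    u * u * u * u₁ * m + k * u₁ * (v * l)  ≡⟨ solve (u₁ ∷ m₁ ∷ k ∷ v₁ ∷ l ∷ []) ⟩
    u * u * u * u₁ * m + k * v * (u₁ * l)  ≡⟨ cong (λ t → u * u * u * u₁ * m + k * v * t) u₁l≡v₁m ⟩
    u * u * u * u₁ * m + k * v * (v₁ * m)  ≡⟨ solve (u₁ ∷ m₁ ∷ k ∷ v₁ ∷ []) ⟩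
    m * (u * u * u * u₁ + k * v * v₁)      ∎)

square-of-difference : ∀ {w} a b → w + b ≡ a ⊎ a + w ≡ b → w ^ 2 + 2 * a * b ≡ a ^ 2 + b ^ 2
square-of-difference {w} _ b (inj₁ refl) =
  +-*-Solver.solve 2 (λ w b → w :^ 2 :+ con 2 :* (w :+ b) :* b := (w :+ b) :^ 2 :+ b :^ 2) refl w b
square-of-difference {w} a _ (inj₂ refl) =
  +-*-Solver.solve 2 (λ w a → w :^ 2 :+ con 2 :* a :* (a :+ w) := a :^ 2 :+ (a :+ w) :^ 2) refl w a

-- Writing k = 4 + k′ and u = k + 1 + e, the remainder u² (8u − 4 − 2k) + k of the header
-- is u² (6k + 4 + 8e) + k′ + 4.
quadratic-identity : ∀ k′ e v →
  k′ * suc (4 + k′ + e) ^ 4 + suc (suc (4 + k′ + e) ^ 2 * (6 * (4 + k′) + 4 + 8 * e) + k′ + 3)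
    + 4 * ((suc (4 + k′ + e) * (4 + k′ + e)) * (suc (4 + k′ + e) * (4 + k′ + e))
           + (4 + k′) * (v * v + suc (4 + k′ + e) * suc (4 + k′ + e)))
    ≡ (4 + k′) * ((suc (4 + k′ + e) ^ 2 + 1) ^ 2 + (2 * v) ^ 2)
quadratic-identity = +-*-Solver.solve 3 (λ k′ e v → let k = con 4 :+ k′ ; u = con 1 :+ (k :+ e) in
   k′ :* u :^ 4 :+ (con 1 :+ (u :^ 2 :* (con 6 :* k :+ con 4 :+ con 8 :* e) :+ k′ :+ con 3))
   :+ con 4 :* ((u :* (k :+ e)) :* (u :* (k :+ e)) :+ k :* (v :* v :+ u :* u))
   := k :* ((u :^ 2 :+ con 1) :^ 2 :+ (con 2 :* v) :^ 2)) refl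

quadratic≥0⇒bound : ∀ {k u v} → 4 ≤ k → k < u → Quadratic≥0 k u v →
  ∀ w → w + 2 * v ≡ u ^ 2 + 1 ⊎ u ^ 2 + 1 + w ≡ 2 * v → (k ∸ 4) * u ^ 4 < k * w ^ 2
quadratic≥0⇒bound {k} {u} {v} 4≤k k<u P[v]≥0 w w≡∣a-b∣
  with m≤n⇒∃[o]m+o≡n 4≤k | m≤n⇒∃[o]m+o≡n k<u
... | k′ , refl | e , refl = <-≤-trans (m<m+n (k′ * u ^ 4) (s≤s z≤n))
  (+-cancelʳ-≤ (k * (2 * (u ^ 2 + 1) * (2 * v))) _ _ (begin
    k′ * u ^ 4 + R + k * (2 * (u ^ 2 + 1) * (2 * v))
      ≡⟨ cong (k′ * u ^ 4 + R +_) (+-*-Solver.solve 3 (λ k u v → k :* (con 2 :* (u :^ 2 :+ con 1) :* (con 2 :* v))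
                                         := con 4 :* (k :* (u :* u :+ con 1) :* v)) refl k u v) ⟩
    k′ * u ^ 4 + R + 4 * (k * (u * u + 1) * v)
      ≤⟨ +-monoʳ-≤ (k′ * u ^ 4 + R) (*-monoʳ-≤ 4 P[v]≥0) ⟩
    k′ * u ^ 4 + R + 4 * ((u * (u ∸ 1)) * (u * (u ∸ 1)) + k * (v * v + u * u))
      ≡⟨ quadratic-identity k′ e v ⟩
    k * ((u ^ 2 + 1) ^ 2 + (2 * v) ^ 2)
      ≡⟨ cong (k *_) (square-of-difference (u ^ 2 + 1) (2 * v) w≡∣a-b∣) ⟨
    k * (w ^ 2 + 2 * (u ^ 2 + 1) * (2 * v))
      ≡⟨ *-distribˡ-+ k (w ^ 2) _ ⟩
    k * w ^ 2 + k * (2 * (u ^ 2 + 1) * (2 * v)) ∎))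
  where
  open ≤-Reasoning
  R = suc (u ^ 2 * (6 * k + 4 + 8 * e) + k′ + 3)

conditions-of-bound : ∀ {k u v} →
  (∀ w → w + 2 * v ≡ u ^ 2 + 1 ⊎ u ^ 2 + 1 + w ≡ 2 * v → (k ∸ 4) * u ^ 4 < k * w ^ 2) →
  CondA k v u ⊎ CondB k v u
conditions-of-bound {k} {u} {v} bound with <-cmp (2 * v) (u ^ 2 + 1)
... | tri< b<a _ _ = inj₁ (b<a , bound (u ^ 2 + 1 ∸ 2 * v) (inj₁ (m∸n+n≡m (<⇒≤ b<a))))
... | tri≈ _ b≡a _ = contradiction (<-≤-trans (bound 0 (inj₁ b≡a)) (≤-reflexive (*-zeroʳ k))) n≮0
... | tri> _ _ a<b = inj₂ (a<b , bound (2 * v ∸ (u ^ 2 + 1)) (inj₂ (m+[n∸m]≡n (<⇒≤ a<b))))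

-- Counting around a minimal sub-BIBD

module AroundMinimal {v b k l m u : ℕ} {Bs : Fin b → Subset v} (D : IsDesign Bs k)
  (LF : ∀ x → ExactlyN (λ T → MinimalSubBIBD Bs k T × x ∈ proj₁ T) l)
  (MF : ∀ i → ExactlyN (λ T → MinimalSubBIBD Bs k T × i ∈ proj₂ T) m)
  (hu : ∀ V′ I → MinimalSubBIBD Bs k (V′ , I) → ∣ V′ ∣ ≡ u)
  {A : Subset v} {I : Subset b} (S-min : MinimalSubBIBD Bs k (A , I)) where

  open MinimalSubBIBDs D LF MF
  open PairwiseBalanced B replication index

  S : IsBIBD A Bs I k 1
  S = proj₁ S-min

  ∣A∣≡u : ∣ A ∣ ≡ u
  ∣A∣≡u = hu A I S-min

  k<u : k < u
  k<u = subst (k <_) ∣A∣≡u (IsBIBD.nontrivial S)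

  c : Fin g → ℕ
  c t = ∣ A ∩ B t ∣

  0<u : 0 < u
  0<u = ≤-trans (s≤s z≤n) k<u

  0<v : 0 < v
  0<v = ≤-trans 0<u (subst (_≤ v) ∣A∣≡u (∣p∣≤n A))

  ∑c≡ul : ∑[ t < g ] c t ≡ u * l
  ∑c≡ul = trans (∑∣∩∣ A) (cong (_* l) ∣A∣≡u)

  ∑c²+um≡ul+uum : ∑[ t < g ] (c t * c t) + u * m ≡ u * l + u * u * m
  ∑c²+um≡ul+uum = begin
    ∑[ t < g ] (c t * c t) + u * m          ≡⟨ cong (λ a → ∑[ t < g ] (c t * c t) + a * m) ∣A∩A∣≡u ⟨
    ∑[ t < g ] (c t * c t) + ∣ A ∩ A ∣ * m  ≡⟨ ∑∣∩∣*∣∩∣ A A ⟩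
    ∣ A ∩ A ∣ * l + ∣ A ∣ * ∣ A ∣ * m       ≡⟨ cong₂ (λ a b → a * l + b * b * m) ∣A∩A∣≡u ∣A∣≡u ⟩
    u * l + u * u * m                       ∎
    where
    open ≡-Reasoning
    ∣A∩A∣≡u = trans (cong ∣_∣ (∩-idem A)) ∣A∣≡u

  ∣⊤∩B∣≡u : ∀ t → ∣ ⊤ ∩ B t ∣ ≡ u
  ∣⊤∩B∣≡u t = trans (cong ∣_∣ (∩-identityˡ (B t))) (hu _ _ (B-minimal t))

  gu≡vl : g * u ≡ v * l
  gu≡vl = begin
    g * u                   ≡⟨ ∑-const g u ⟨
    ∑[ t < g ] u            ≡⟨ sum-cong-≗ (sym ∘ ∣⊤∩B∣≡u) ⟩
    ∑[ t < g ] ∣ ⊤ ∩ B t ∣  ≡⟨ ∑∣∩∣ ⊤ ⟩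
    ∣ ⊤ {v} ∣ * l           ≡⟨ cong (_* l) (∣⊤∣≡n v) ⟩
    v * l                   ∎
    where open ≡-Reasoning

  ul+m≡l+vm : u * l + m ≡ l + v * m
  ul+m≡l+vm = *-cancelˡ-≡ _ _ u {{>-nonZero 0<u}} (begin
    u * (u * l + m)                               ≡⟨ solve (u ∷ l ∷ m ∷ []) ⟩
    u * l * u + u * m                             ≡⟨ cong₂ (λ a b → a * u + b * m) ∑c≡ul ∣A∩⊤∣≡u ⟨
    ∑[ t < g ] c t * u + ∣ A ∩ ⊤ ∣ * m            ≡⟨ cong (_+ ∣ A ∩ ⊤ ∣ * m) (*-distribʳ-sum u c) ⟩
    ∑[ t < g ] (c t * u) + ∣ A ∩ ⊤ ∣ * m          ≡⟨ cong (_+ ∣ A ∩ ⊤ ∣ * m) (sum-cong-≗ λ t → cong (c t *_) (∣⊤∩B∣≡u t)) ⟨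
    ∑[ t < g ] (c t * ∣ ⊤ ∩ B t ∣) + ∣ A ∩ ⊤ ∣ * m ≡⟨ ∑∣∩∣*∣∩∣ A ⊤ ⟩
    ∣ A ∩ ⊤ ∣ * l + ∣ A ∣ * ∣ ⊤ {v} ∣ * m          ≡⟨ cong₂ (λ a b → a * l + ∣ A ∣ * b * m) ∣A∩⊤∣≡u (∣⊤∣≡n v) ⟩
    u * l + ∣ A ∣ * v * m                         ≡⟨ cong (λ a → u * l + a * v * m) ∣A∣≡u ⟩
    u * l + u * v * m                             ≡⟨ solve (u ∷ l ∷ v ∷ m ∷ []) ⟩
    u * (l + v * m)                               ∎)
    where
    open ≡-Reasoning
    ∣A∩⊤∣≡u = trans (cong ∣_∣ (∩-identityʳ A)) ∣A∣≡u

  [k+1]ul≤∑c²+gk : (k + 1) * (u * l) ≤ ∑[ t < g ] (c t * c t) + g * k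
  [k+1]ul≤∑c²+gk = begin
    (k + 1) * (u * l)                        ≡⟨ cong ((k + 1) *_) ∑c≡ul ⟨
    (k + 1) * ∑[ t < g ] c t                 ≡⟨ *-distribˡ-sum (k + 1) c ⟩
    ∑[ t < g ] ((k + 1) * c t)               ≤⟨ ∑-mono-≤ (λ t → [k+1]*c≤c*c+k (∣∩∣≤1⊎k≤∣∩∣ D S (proj₁ (B-minimal t)))) ⟩
    ∑[ t < g ] (c t * c t + k)               ≡⟨ ∑-distrib-+ (λ t → c t * c t) (λ _ → k) ⟩
    ∑[ t < g ] (c t * c t) + ∑[ t < g ] k    ≡⟨ cong (∑[ t < g ] (c t * c t) +_) (∑-const g k) ⟩
    ∑[ t < g ] (c t * c t) + g * k           ∎
    where open ≤-Reasoning

  P[v]≥0 : Quadratic≥0 k u v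
  P[v]≥0 = quadratic≥0 {k} {u} {v} {l} {m} {g} 0<u 0<v (0<m S-min) ∑c²+um≡ul+uum gu≡vl ul+m≡l+vm [k+1]ul≤∑c²+gk

conditions? : ∀ k v u → Dec (CondA k v u ⊎ CondB k v u)
conditions? k v u =
  (2 * v <? u ^ 2 + 1 ×-dec (k ∸ 4) * u ^ 4 <? k * (u ^ 2 + 1 ∸ 2 * v) ^ 2) ⊎-dec
  (u ^ 2 + 1 <? 2 * v ×-dec (k ∸ 4) * u ^ 4 <? k * (2 * v ∸ (u ^ 2 + 1)) ^ 2)

lemma2p16 : (v b k : ℕ) (Bs : Fin b → Subset v) → IsDesign Bs k →
    WellDistributed Bs k → (v' : ℕ) →
    (∀ (V' : Subset v) (I : Subset b) → MinimalSubBIBD Bs k (V' , I) → ∣ V' ∣ ≡ v') →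
    4 ≤ k → CondA k v v' ⊎ CondB k v v'
lemma2p16 v b k Bs D (l , m , LF , MF) u hu 4≤k =
  decidable-stable (conditions? k v u) λ ¬conditions →
    ¬¬-minimal-sub-BIBD D λ (_ , S-min) →
      let open AroundMinimal D LF MF hu S-min in
      ¬conditions (conditions-of-bound {k} {u} {v} (quadratic≥0⇒bound 4≤k k<u P[v]≥0))
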